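{- Let $A\subseteq\mathbb N$ be hypersimple. Then for every $n\in\mathbb N$, $\omega\not\leq F_A^{n+}$.
   Context: A ceer is an equivalence relation on $\mathbb N$ c.e. as a subset of $\mathbb N^2$; $R_1\leq R_2$ means there is a total computable $f$ with $xR_1y\Leftrightarrow f(x)R_2f(y)$. $\omega$ is the identity relation on $\mathbb N$. A c.e. set $A$ is hypersimple if its complement is infinite and no computable $f$ satisfies $f(n)\geq z_n$ for all $n$, where $z_0<z_1<\cdots$ enumerates $\mathbb N\setminus A$. For c.e. $A$, $xF_Ay\Leftrightarrow x=y\lor\forall z(\min(x,y)\leq z\leq\max(x,y)\to z\in A)$. The saturation jump $E^+$ of a ceer $E$ is the equivalence relation on finite subsets of $\mathbb N$ (identified with $\mathbb N$ via a fixed computable bijection) given by $xE^+y\Leftrightarrow [x]_E=[y]_E$, where $[X]_E=\{y:\exists x\in X\,(xEy)\}$; $E^{0+}=E$, $E^{(n+1)+}=(E^{n+})^+$. -}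

module Defs where

open import Data.Nat using (ℕ; zero; suc; _≤_; _<_; ⌊_/2⌋)
open import Data.Fin using (Fin)
open import Data.Vec using (Vec; []; _∷_; lookup)
open import Data.Maybe using (Maybe; just; nothing; Is-just)
open import Data.Bool using (Bool; true; false; not)
open import Data.Product using (Σ; ∃; _×_; _,_)
open import Data.Sum using (_⊎_)
open import Relation.Nullary using (¬_)
open import Relation.Binary.PropositionalEquality using (_≡_)

data PR : ℕ → Set where
  zer  : ∀ {n} → PR n
  succ : PR 1
  proj : ∀ {n} → Fin n → PR n
  comp : ∀ {k n} → PR k → Vec (PR n) k → PR n
  prec : ∀ {n} → PR n → PR (suc (suc n)) → PR (suc n)
  mu   : ∀ {n} → PR (suc n) → PR n

mutual
  eval : ℕ → ∀ {n} → PR n → Vec ℕ n → Maybe ℕ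
  eval zero    _          _  = nothing
  eval (suc s) zer        _  = just 0
  eval (suc s) succ (x ∷ []) = just (suc x)
  eval (suc s) (proj i)   xs = just (lookup xs i)
  eval (suc s) (comp f gs) xs with evalVec s gs xs
  ... | just ys = eval s f ys
  ... | nothing = nothing
  eval (suc s) (prec g h) (m ∷ xs) = evalRec s g h m xs
  eval (suc s) (mu f)     xs = search s f 0 xs

  evalVec : ℕ → ∀ {k n} → Vec (PR n) k → Vec ℕ n → Maybe (Vec ℕ k)
  evalVec s []       xs = just []
  evalVec s (g ∷ gs) xs with eval s g xs | evalVec s gs xs
  ... | just y  | just ys = just (y ∷ ys)
  ... | _       | _       = nothing

  evalRec : ℕ → ∀ {n} → PR n → PR (suc (suc n)) → ℕ → Vec ℕ n → Maybe ℕ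
  evalRec s g h zero    xs = eval s g xs
  evalRec s g h (suc m) xs with evalRec s g h m xs
  ... | just r  = eval s h (m ∷ r ∷ xs)
  ... | nothing = nothing

  search : ℕ → ∀ {n} → PR (suc n) → ℕ → Vec ℕ n → Maybe ℕ
  search zero    f y xs = nothing
  search (suc s) f y xs with eval s f (y ∷ xs)
  ... | just zero    = just y
  ... | just (suc _) = search s f (suc y) xs
  ... | nothing      = nothing

Computable : (ℕ → ℕ) → Set
Computable f = Σ (PR 1) λ c → ∀ x → ∃ λ s → eval s c (x ∷ []) ≡ just (f x)

CE : (ℕ → Set) → Set
CE A = Σ (PR 1) λ c → ∀ x →
  (A x → ∃ λ s → Is-just (eval s c (x ∷ []))) × ((∃ λ s → Is-just (eval s c (x ∷ []))) → A x)

-- NthOut A n z : z is the n-th element (counting from 0) of ℕ ∖ A, i.e. z = z_n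
NthOut : (ℕ → Set) → ℕ → ℕ → Set
NthOut A zero    z = ¬ A z × (∀ y → y < z → A y)
NthOut A (suc n) z = ¬ A z × ∃ λ w → w < z × NthOut A n w × (∀ y → w < y → y < z → A y)

CoInfinite : (ℕ → Set) → Set
CoInfinite A = ∀ m → ∃ λ z → m ≤ z × ¬ A z

Hypersimple : (ℕ → Set) → Set
Hypersimple A = CE A × CoInfinite A ×
  ¬ (∃ λ f → Computable f × (∀ n z → NthOut A n z → z ≤ f n))

Rel : Set₁
Rel = ℕ → ℕ → Set

ω : Rel
ω x y = x ≡ y

_≤ᶜ_ : Rel → Rel → Set
R ≤ᶜ S = ∃ λ f → Computable f × (∀ x y → (R x y → S (f x) (f y)) × (S (f x) (f y) → R x y))

F : (ℕ → Set) → Rel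
F A x y = x ≡ y ⊎ (∀ z → (x ≤ z → z ≤ y → A z) × (y ≤ z → z ≤ x → A z))

-- Saturation jump. Finite sets are coded canonically: x codes
-- D_x = { i | the i-th binary digit of x is 1 }.

isOdd : ℕ → Bool
isOdd zero    = false
isOdd (suc n) = not (isOdd n)

testBit : ℕ → ℕ → Bool
testBit x zero    = isOdd x
testBit x (suc i) = testBit ⌊ x /2⌋ i

InD : ℕ → ℕ → Set
InD x i = testBit x i ≡ true

InSat : Rel → ℕ → ℕ → Set
InSat E x z = ∃ λ a → InD x a × E a z

Jump : Rel → Rel
Jump E x y = ∀ z → (InSat E x z → InSat E y z) × (InSat E y z → InSat E x z)

JumpIter : ℕ → Rel → Rel
JumpIter zero    E = E
JumpIter (suc n) E = Jump (JumpIter n E)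

module Submission where

-- Idea.  Suppose f reduces ω to E = F_A^{n+}.  Let z = z_m be the m-th element of
-- the complement of A.  Below z the complement of A has only m elements, so the
-- numbers below z fall into at most 2^(2m) F_A-classes (a number is determined up to
-- F_A by its position relative to those m points), and each saturation jump turns
-- N classes below z into at most 2^N classes below z (a finite set D_x with x < z is
-- determined up to saturation by which classes it meets).  Hence below z there are at
-- most L = classBound n m classes of E.  Since f is injective on E-classes, some
-- f(i) with i ≤ L must be ≥ z, so z_m ≤ f 0 + ⋯ + f L.  The right-hand side is a
-- computable function of m, contradicting hypersimplicity.

open import Defs
open import Data.Nat using (ℕ; zero; suc; _+_; _≤_; _<_; _⊔_; _≤′_; ≤′-refl; ≤′-step; _≤?_; _<?_; _≟_; ⌊_/2⌋; z≤n; s≤s)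
open import Data.Nat.Properties using (≤⇒≤′; m≤m⊔n; m≤n⊔m; ≤-refl; ≤-trans; ≤-antisym; ≤-pred; ≤-<-trans; <-trans; <⇒≤; <⇒≱; <-irrefl; <-cmp; ≰⇒>; n<1+n; m≤m+n; m≤n+m; ≤∧≢⇒<; m≤n⇒m<n∨m≡n; ⌊n/2⌋<n)
open import Data.Fin using (Fin; toℕ; fromℕ<; splitAt; _↑ˡ_; _↑ʳ_)
open import Data.Fin.Patterns using (0F; 1F)
open import Data.Fin.Properties using (splitAt-↑ˡ; splitAt-↑ʳ; toℕ-fromℕ<; toℕ<n; any?; pigeonhole) renaming (_≟_ to _≟ᶠ_)
open import Data.Vec using (Vec; []; _∷_; head; tail; lookup; map; _++_; tabulate)
open import Data.Vec.Properties using (++-injectiveˡ; ++-injectiveʳ; ∷-injectiveˡ; ∷-injectiveʳ; lookup∘tabulate)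
open import Data.Vec.Membership.Propositional using (_∈_)
open import Data.Vec.Relation.Unary.Any using (here; there)
open import Data.Bool using (Bool; true; false) renaming (_≟_ to _≟ᵇ_)
open import Data.Maybe using (just; nothing)
open import Data.Product using (∃; _×_; _,_; proj₁; proj₂)
open import Data.Sum using (_⊎_; inj₁; inj₂; map₁)
open import Data.Empty using (⊥-elim)
open import Relation.Nullary using (¬_; Dec; yes; no; does)
open import Relation.Nullary.Decidable using (dec-true; _×-dec_)
open import Relation.Binary.Definitions using (Transitive; tri<; tri≈; tri>)
open import Relation.Binary.PropositionalEquality

mutual
  eval-step : ∀ s {n} (c : PR n) {xs v} → eval s c xs ≡ just v → eval (suc s) c xs ≡ just v
  eval-step zero    c                ()
  eval-step (suc s) zer              eq = eq
  eval-step (suc s) succ {_ ∷ []}    eq = eq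
  eval-step (suc s) (proj i)         eq = eq
  eval-step (suc s) (comp f gs) {xs} eq with evalVec s gs xs in e
  ... | just ys rewrite evalVec-step s gs e = eval-step s f eq
  eval-step (suc s) (comp f gs) () | nothing
  eval-step (suc s) (prec g h) {m ∷ xs} eq = evalRec-step s g h m eq
  eval-step (suc s) (mu f)           eq = search-step s f 0 eq

  evalVec-step : ∀ s {k n} (gs : Vec (PR n) k) {xs vs} → evalVec s gs xs ≡ just vs → evalVec (suc s) gs xs ≡ just vs
  evalVec-step s [] eq = eq
  evalVec-step s (g ∷ gs) {xs} eq with eval s g xs in e₁ | evalVec s gs xs in e₂
  ... | just _ | just _ rewrite eval-step s g e₁ | evalVec-step s gs e₂ = eq
  evalVec-step s (g ∷ gs) () | just _ | nothing
  evalVec-step s (g ∷ gs) () | nothing | _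

  evalRec-step : ∀ s {n} (g : PR n) h m {xs v} → evalRec s g h m xs ≡ just v → evalRec (suc s) g h m xs ≡ just v
  evalRec-step s g h zero eq = eval-step s g eq
  evalRec-step s g h (suc m) {xs} eq with evalRec s g h m xs in e
  ... | just r rewrite evalRec-step s g h m e = eval-step s h eq
  evalRec-step s g h (suc m) () | nothing

  search-step : ∀ s {n} (f : PR (suc n)) y {xs v} → search s f y xs ≡ just v → search (suc s) f y xs ≡ just v
  search-step zero f y ()
  search-step (suc s) f y {xs} eq with eval s f (y ∷ xs) in e
  ... | just zero    rewrite eval-step s f e = eq
  ... | just (suc _) rewrite eval-step s f e = search-step s f (suc y) eq
  search-step (suc s) f y () | nothing

upward : {P : ℕ → Set} → (∀ {s} → P s → P (suc s)) → ∀ {s s'} → s ≤ s' → P s → P s'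
upward {P} step le = go (≤⇒≤′ le)
  where
  go : ∀ {s s'} → s ≤′ s' → P s → P s'
  go ≤′-refl      p = p
  go (≤′-step le) p = step (go le p)

eval-mono : ∀ {n} (c : PR n) {xs v s s'} → s ≤ s' → eval s c xs ≡ just v → eval s' c xs ≡ just v
eval-mono c {xs} {v} = upward {P = λ s → eval s c xs ≡ just v} (eval-step _ c)

evalVec-mono : ∀ {k n} (gs : Vec (PR n) k) {xs vs s s'} → s ≤ s' → evalVec s gs xs ≡ just vs → evalVec s' gs xs ≡ just vs
evalVec-mono gs {xs} {vs} = upward {P = λ s → evalVec s gs xs ≡ just vs} (evalVec-step _ gs)

evalRec-mono : ∀ {n} (g : PR n) h m {xs v s s'} → s ≤ s' → evalRec s g h m xs ≡ just v → evalRec s' g h m xs ≡ just v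
evalRec-mono g h m {xs} {v} = upward {P = λ s → evalRec s g h m xs ≡ just v} (evalRec-step _ g h m)

record Computes {n} (G : Vec ℕ n → ℕ) : Set where
  constructor computes
  field
    code : PR n
    runs : ∀ xs → ∃ λ s → eval s code xs ≡ just (G xs)

record ComputesVec {k n} (G : Vec ℕ n → Vec ℕ k) : Set where
  constructor computes
  field
    codes : Vec (PR n) k
    runs  : ∀ xs → ∃ λ s → evalVec s codes xs ≡ just (G xs)

computes-cong : ∀ {n} {G G' : Vec ℕ n → ℕ} → (∀ xs → G xs ≡ G' xs) → Computes G → Computes G'
computes-cong G≗G' (computes c run) = computes c λ xs → let s , e = run xs in s , trans e (cong just (G≗G' xs))

computes-zer : ∀ {n} → Computes {n} (λ _ → 0)
computes-zer = computes zer λ xs → 1 , refl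

computes-succ : Computes (λ xs → suc (head xs))
computes-succ = computes succ λ { (x ∷ []) → 1 , refl }

computes-proj : ∀ {n} (i : Fin n) → Computes (λ xs → lookup xs i)
computes-proj i = computes (proj i) λ xs → 1 , refl

computes-[] : ∀ {n} → ComputesVec {n = n} (λ _ → [])
computes-[] = computes [] λ xs → 0 , refl

computes-∷ : ∀ {k n} {G : Vec ℕ n → ℕ} {Gs : Vec ℕ n → Vec ℕ k} →
             Computes G → ComputesVec Gs → ComputesVec (λ xs → G xs ∷ Gs xs)
computes-∷ {G = G} {Gs} (computes g sg) (computes gs sgs) = computes (g ∷ gs) λ xs →
  let s₁ , e₁ = sg xs ; s₂ , e₂ = sgs xs in s₁ ⊔ s₂ , both xs s₁ s₂ e₁ e₂
  where
  both : ∀ xs s₁ s₂ → eval s₁ g xs ≡ just (G xs) → evalVec s₂ gs xs ≡ just (Gs xs) →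
         evalVec (s₁ ⊔ s₂) (g ∷ gs) xs ≡ just (G xs ∷ Gs xs)
  both xs s₁ s₂ e₁ e₂ rewrite eval-mono g (m≤m⊔n s₁ s₂) e₁ | evalVec-mono gs (m≤n⊔m s₁ s₂) e₂ = refl

computes-comp : ∀ {k n} {F : Vec ℕ k → ℕ} {G : Vec ℕ n → Vec ℕ k} →
                Computes F → ComputesVec G → Computes (λ xs → F (G xs))
computes-comp {F = F} {G} (computes f sf) (computes gs sgs) = computes (comp f gs) λ xs →
  let s₁ , e₁ = sgs xs ; s₂ , e₂ = sf (G xs) in suc (s₁ ⊔ s₂) , run xs s₁ s₂ e₁ e₂
  where
  run : ∀ xs s₁ s₂ → evalVec s₁ gs xs ≡ just (G xs) → eval s₂ f (G xs) ≡ just (F (G xs)) →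
        eval (suc (s₁ ⊔ s₂)) (comp f gs) xs ≡ just (F (G xs))
  run xs s₁ s₂ e₁ e₂ rewrite evalVec-mono gs (m≤m⊔n s₁ s₂) e₁ = eval-mono f (m≤n⊔m s₁ s₂) e₂

Rec : ∀ {n} → (Vec ℕ n → ℕ) → (Vec ℕ (suc (suc n)) → ℕ) → ℕ → Vec ℕ n → ℕ
Rec G H zero    xs = G xs
Rec G H (suc m) xs = H (m ∷ Rec G H m xs ∷ xs)

computes-prec : ∀ {n} {G : Vec ℕ n → ℕ} {H : Vec ℕ (suc (suc n)) → ℕ} →
                Computes G → Computes H → Computes (λ xs → Rec G H (head xs) (tail xs))
computes-prec {G = G} {H} (computes g sg) (computes h sh) = computes (prec g h) λ { (m ∷ xs) →
  let s , e = unfold xs m in suc s , e }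
  where
  unfold : ∀ xs m → ∃ λ s → evalRec s g h m xs ≡ just (Rec G H m xs)
  unfold xs zero    = sg xs
  unfold xs (suc m) = let s₁ , e₁ = unfold xs m ; s₂ , e₂ = sh (m ∷ Rec G H m xs ∷ xs) in s₁ ⊔ s₂ , step s₁ s₂ e₁ e₂
    where
    step : ∀ s₁ s₂ → evalRec s₁ g h m xs ≡ just (Rec G H m xs) → eval s₂ h (m ∷ Rec G H m xs ∷ xs) ≡ just (Rec G H (suc m) xs) →
           evalRec (s₁ ⊔ s₂) g h (suc m) xs ≡ just (Rec G H (suc m) xs)
    step s₁ s₂ e₁ e₂ rewrite evalRec-mono g h m (m≤m⊔n s₁ s₂) e₁ = eval-mono h (m≤n⊔m s₁ s₂) e₂

computable : ∀ {G : Vec ℕ 1 → ℕ} → Computes G → Computable (λ x → G (x ∷ []))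
computable (computes c run) = c , λ x → run (x ∷ [])

computes-of : ∀ {f} → Computable f → Computes (λ xs → f (head xs))
computes-of (c , run) = computes c λ { (x ∷ []) → run x }

computable-cong : ∀ {f g} → (∀ x → f x ≡ g x) → Computable f → Computable g
computable-cong f≗g (c , run) = c , λ x → let s , e = run x in s , trans e (cong just (f≗g x))

computable-∘ : ∀ {f g} → Computable f → Computable g → Computable (λ x → f (g x))
computable-∘ cf cg = computable (computes-comp (computes-of cf) (computes-∷ (computes-of cg) computes-[]))

add-computes : Computes (λ xs → head xs + head (tail xs))
add-computes = computes-cong rec-is-+
  (computes-prec (computes-proj 0F) (computes-comp computes-succ (computes-∷ (computes-proj 1F) computes-[])))
  where
  rec-is-+ : (xs : Vec ℕ 2) → Rec (λ ys → lookup ys 0F) (λ ys → suc (lookup ys 1F)) (head xs) (tail xs) ≡ head xs + head (tail xs)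
  rec-is-+ (a ∷ b ∷ []) = go a
    where
    go : ∀ a → Rec (λ ys → lookup ys 0F) (λ ys → suc (lookup ys 1F)) a (b ∷ []) ≡ a + b
    go zero    = refl
    go (suc a) = cong suc (go a)

double-computable : Computable (λ m → m + m)
double-computable = computable (computes-comp add-computes (computes-∷ (computes-proj 0F) (computes-∷ (computes-proj 0F) computes-[])))

-- Powers of two, by doubling; the recursion matches the binary codes below.
pow2 : ℕ → ℕ
pow2 zero    = 1
pow2 (suc s) = pow2 s + pow2 s

pow2-computable : Computable pow2
pow2-computable = computable-cong rec-is-pow2
  (computable (computes-prec (computes-comp computes-succ (computes-∷ computes-zer computes-[]))
                         (computes-comp add-computes (computes-∷ (computes-proj 1F) (computes-∷ (computes-proj 1F) computes-[])))))
  where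
  rec-is-pow2 : ∀ a → Rec (λ _ → 1) (λ ys → lookup ys 1F + lookup ys 1F) a [] ≡ pow2 a
  rec-is-pow2 zero    = refl
  rec-is-pow2 (suc a) = cong₂ _+_ (rec-is-pow2 a) (rec-is-pow2 a)

sumUpTo : (ℕ → ℕ) → ℕ → ℕ
sumUpTo f zero    = f 0
sumUpTo f (suc k) = sumUpTo f k + f (suc k)

sumUpTo-≥ : ∀ f {i k} → i ≤ k → f i ≤ sumUpTo f k
sumUpTo-≥ f {zero}  {zero}  _ = ≤-refl
sumUpTo-≥ f {i}     {suc k} i≤k with i ≟ suc k
... | yes refl = m≤n+m (f (suc k)) (sumUpTo f k)
... | no  i≢k  = ≤-trans (sumUpTo-≥ f (≤-pred (≤∧≢⇒< i≤k i≢k))) (m≤m+n (sumUpTo f k) (f (suc k)))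

sumUpTo-computable : ∀ {f} → Computable f → Computable (sumUpTo f)
sumUpTo-computable {f} cf = computable-cong rec-is-sum
  (computable (computes-prec (computes-comp (computes-of cf) (computes-∷ computes-zer computes-[]))
                         (computes-comp add-computes (computes-∷ (computes-proj 1F)
                           (computes-∷ (computes-comp (computes-of cf) (computes-∷ (computes-comp computes-succ (computes-∷ (computes-proj 0F) computes-[])) computes-[]))
                            computes-[])))))
  where
  rec-is-sum : ∀ a → Rec (λ _ → f 0) (λ ys → lookup ys 1F + f (suc (lookup ys 0F))) a [] ≡ sumUpTo f a
  rec-is-sum zero    = refl
  rec-is-sum (suc a) = cong (_+ f (suc a)) (rec-is-sum a)

-- classBound k m bounds the number of classes of F_A^{k+} below z_m.
classBound : ℕ → ℕ → ℕ
classBound zero    m = pow2 (m + m)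
classBound (suc k) m = pow2 (classBound k m)

classBound-computable : ∀ k → Computable (classBound k)
classBound-computable zero    = computable-∘ pow2-computable double-computable
classBound-computable (suc k) = computable-∘ pow2-computable (classBound-computable k)

-- F_A is transitive: two overlapping or adjacent intervals inside A cover their union.
F-trans : ∀ {A} → Transitive (F A)
F-trans (inj₁ refl) q = q
F-trans p (inj₁ refl) = p
F-trans {A} {x} {y} {w} (inj₂ p) (inj₂ q) = inj₂ λ t → upward-gap t , downward-gap t
  where
  upward-gap : ∀ t → x ≤ t → t ≤ w → A t
  upward-gap t x≤t t≤w with t ≤? y
  ... | yes t≤y = proj₁ (p t) x≤t t≤y
  ... | no  t≰y = proj₁ (q t) (<⇒≤ (≰⇒> t≰y)) t≤w
  downward-gap : ∀ t → w ≤ t → t ≤ x → A t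
  downward-gap t w≤t t≤x with t ≤? y
  ... | yes t≤y = proj₂ (q t) w≤t t≤y
  ... | no  t≰y = proj₂ (p t) (<⇒≤ (≰⇒> t≰y)) t≤x

-- The saturation jump of any relation is transitive (it is equality of saturations).
Jump-trans : ∀ {E} → Transitive (Jump E)
Jump-trans j₁ j₂ t = (λ h → proj₁ (j₂ t) (proj₁ (j₁ t) h)) , (λ h → proj₂ (j₁ t) (proj₂ (j₂ t) h))

JumpIter-trans : ∀ {E} → Transitive E → ∀ k → Transitive (JumpIter k E)
JumpIter-trans E-trans zero    = E-trans
JumpIter-trans E-trans (suc k) = Jump-trans

D₀-empty : ∀ i → ¬ InD 0 i
D₀-empty zero    ()
D₀-empty (suc i) i∈D₀ = D₀-empty i i∈D₀

InD⇒< : ∀ {x i} → InD x i → i < x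
InD⇒< {zero}  {i}     i∈x = ⊥-elim (D₀-empty i i∈x)
InD⇒< {suc x} {zero}  _   = s≤s z≤n
InD⇒< {suc x} {suc i} i∈x = ≤-trans (s≤s (InD⇒< {⌊ suc x /2⌋} {i} i∈x)) (⌊n/2⌋<n x)

encode : ∀ {s} → Vec Bool s → Fin (pow2 s)
encode {zero}  []          = 0F
encode {suc s} (true  ∷ v) = encode v ↑ˡ pow2 s
encode {suc s} (false ∷ v) = pow2 s ↑ʳ encode v

decode : ∀ {s} → Fin (pow2 s) → Vec Bool s
decode {zero}  _ = []
decode {suc s} i with splitAt (pow2 s) i
... | inj₁ j = true  ∷ decode j
... | inj₂ j = false ∷ decode j

decode-encode : ∀ {s} (v : Vec Bool s) → decode (encode v) ≡ v
decode-encode {zero}  []          = refl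
decode-encode {suc s} (true  ∷ v) rewrite splitAt-↑ˡ (pow2 s) (encode v) (pow2 s) = cong (true ∷_) (decode-encode v)
decode-encode {suc s} (false ∷ v) rewrite splitAt-↑ʳ (pow2 s) (pow2 s) (encode v) = cong (false ∷_) (decode-encode v)

encode-injective : ∀ {s} {u v : Vec Bool s} → encode u ≡ encode v → u ≡ v
encode-injective {u = u} {v} eq = trans (sym (decode-encode u)) (trans (cong decode eq) (decode-encode v))

from-does : ∀ {P : Set} (d : Dec P) → does d ≡ true → P
from-does (yes p) _ = p

does-transport : ∀ {P Q : Set} (p : Dec P) (q : Dec Q) → does p ≡ does q → P → Q
does-transport p q eq a = from-does q (trans (sym eq) (dec-true p a))

map-agree : ∀ {k} {A : Set} (Z : Vec ℕ k) {g h : ℕ → A} → map g Z ≡ map h Z → ∀ {w} → w ∈ Z → g w ≡ h w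
map-agree (_ ∷ Z) eq (here refl) = ∷-injectiveˡ eq
map-agree (_ ∷ Z) eq (there w∈Z) = map-agree Z (∷-injectiveʳ eq) w∈Z

record Classification (E : Rel) (z N : ℕ) : Set where
  field
    label : ℕ → Fin N
    sound : ∀ {x y} → x < z → y < z → label x ≡ label y → E x y

-- Classifying F_A below z, given the (at most m) points Z of the complement of A
-- below z: a number is determined up to F_A by its position relative to Z.
module _ {A : ℕ → Set} {z m : ℕ} (Z : Vec ℕ m) (cover : ∀ w → w < z → w ∈ Z ⊎ A w) where

  profile : ℕ → Vec Bool (m + m)
  profile x = map (λ w → does (w ≤? x)) Z ++ map (λ w → does (w <? x)) Z

  Dominates : ℕ → ℕ → Set
  Dominates x y = ∀ {w} → w ∈ Z → (w ≤ y → w ≤ x) × (w < y → w < x)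

  profile-dominates : ∀ {x y} → profile x ≡ profile y → Dominates x y
  profile-dominates {x} {y} eq w∈Z =
      does-transport (_ ≤? y) (_ ≤? x) (sym (map-agree Z (++-injectiveˡ (map _ Z) (map _ Z) eq) w∈Z))
    , does-transport (_ <? y) (_ <? x) (sym (map-agree Z (++-injectiveʳ (map _ Z) (map _ Z) eq) w∈Z))

  -- If x ≠ y and x dominates y, then no point of Z lies in [x, y], so [x, y] ⊆ A.
  interval-in-A : ∀ {x y} → x ≢ y → y < z → Dominates x y → ∀ w → x ≤ w → w ≤ y → A w
  interval-in-A {x} {y} x≢y y<z dom w x≤w w≤y with cover w (≤-<-trans w≤y y<z)
  ... | inj₂ w∈A = w∈A
  ... | inj₁ w∈Z with m≤n⇒m<n∨m≡n w≤y
  ...   | inj₁ w<y  = ⊥-elim (<⇒≱ (proj₂ (dom w∈Z) w<y) x≤w)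
  ...   | inj₂ refl = ⊥-elim (x≢y (≤-antisym x≤w (proj₁ (dom w∈Z) ≤-refl)))

  F-classification : Classification (F A) z (pow2 (m + m))
  F-classification = record { label = λ x → encode (profile x) ; sound = same-profile }
    where
    same-profile : ∀ {x y} → x < z → y < z → encode (profile x) ≡ encode (profile y) → F A x y
    same-profile {x} {y} x<z y<z eq with x ≟ y
    ... | yes x≡y = inj₁ x≡y
    ... | no  x≢y = inj₂ λ w → interval-in-A x≢y y<z (profile-dominates same) w
                             , interval-in-A (≢-sym x≢y) x<z (profile-dominates (sym same)) w
      where
      same : profile x ≡ profile y
      same = encode-injective eq

-- Classifying the saturation jump: a finite set D_x with x < z is determined up to
-- saturation by the set of classes it meets, so N classes give at most 2^N classes.
module _ {E : Rel} {z N : ℕ} (E-trans : Transitive E) (C : Classification E z N) where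
  open Classification C

  -- does D_x meet the class with label e?  (all elements of D_x are below x)
  meets? : ∀ x e → Dec (∃ λ (i : Fin x) → InD x (toℕ i) × label (toℕ i) ≡ e)
  meets? x e = any? λ i → (testBit x (toℕ i) ≟ᵇ true) ×-dec (label (toℕ i) ≟ᶠ e)

  meets : ℕ → Fin N → Bool
  meets x e = does (meets? x e)

  meets-intro : ∀ x {a} → InD x a → meets x (label a) ≡ true
  meets-intro x {a} a∈x = dec-true (meets? x (label a)) (fromℕ< (InD⇒< a∈x) ,
    subst (λ u → InD x u × label u ≡ label a) (sym (toℕ-fromℕ< (InD⇒< a∈x))) (a∈x , refl))

  meets-elim : ∀ {y e} → meets y e ≡ true → ∃ λ b → b < y × InD y b × label b ≡ e
  meets-elim {y} {e} eq = let i , b∈y , lb≡e = from-does (meets? y e) eq in toℕ i , toℕ<n i , b∈y , lb≡e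

  saturation-transfer : ∀ {x y} → x < z → y < z → (∀ e → meets x e ≡ meets y e) →
                        ∀ t → InSat E x t → InSat E y t
  saturation-transfer {x} x<z y<z same t (a , a∈x , aEt)
    with meets-elim (trans (sym (same (label a))) (meets-intro x a∈x))
  ... | b , b<y , b∈y , lb≡la = b , b∈y , E-trans (sound (<-trans b<y y<z) (<-trans (InD⇒< a∈x) x<z) lb≡la) aEt

  Jump-classification : Classification (Jump E) z (pow2 N)
  Jump-classification = record { label = λ x → encode (tabulate (meets x)) ; sound = same-meets }
    where
    same-meets : ∀ {x y} → x < z → y < z → encode (tabulate (meets x)) ≡ encode (tabulate (meets y)) → Jump E x y
    same-meets {x} {y} x<z y<z eq t = saturation-transfer x<z y<z same t , saturation-transfer y<z x<z (λ e → sym (same e)) t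
      where
      same : ∀ e → meets x e ≡ meets y e
      same e = begin
        meets x e                       ≡⟨ lookup∘tabulate (meets x) e ⟨
        lookup (tabulate (meets x)) e   ≡⟨ cong (λ v → lookup v e) (encode-injective eq) ⟩
        lookup (tabulate (meets y)) e   ≡⟨ lookup∘tabulate (meets y) e ⟩
        meets y e                       ∎
        where open ≡-Reasoning

JumpIter-classification : ∀ {A z m} (Z : Vec ℕ m) → (∀ w → w < z → w ∈ Z ⊎ A w) →
                          ∀ k → Classification (JumpIter k (F A)) z (classBound k m)
JumpIter-classification Z cover zero    = F-classification Z cover
JumpIter-classification Z cover (suc k) =
  Jump-classification (JumpIter-trans F-trans k) (JumpIter-classification Z cover k)

few-classes : ∀ {E z N} → Classification E z N → (f : ℕ → ℕ) → (∀ x y → E (f x) (f y) → x ≡ y) →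
              ¬ (∀ i → i ≤ N → f i < z)
few-classes {z = z} {N} C f f-injective below with pigeonhole (n<1+n N) (λ i → Classification.label C (f (toℕ i)))
... | i , j , i<j , same = <-irrefl (f-injective (toℕ i) (toℕ j) (sound (below-i i) (below-i j) same)) i<j
  where
  open Classification C
  below-i : ∀ (i : Fin (suc N)) → f (toℕ i) < z
  below-i i = below (toℕ i) (≤-pred (toℕ<n i))

complement-below : ∀ {A : ℕ → Set} {m z} → NthOut A m z → ∃ λ (Z : Vec ℕ m) → ∀ w → w < z → w ∈ Z ⊎ A w
complement-below {m = zero}  (_ , below-in-A) = [] , λ w w<z → inj₂ (below-in-A w w<z)
complement-below {m = suc m} {z} (_ , z' , z'<z , nth , gap-in-A) with complement-below nth
... | Z , cover = z' ∷ Z , cover'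
  where
  cover' : ∀ w → w < z → w ∈ (z' ∷ Z) ⊎ _
  cover' w w<z with <-cmp w z'
  ... | tri< w<z' _ _ = map₁ there (cover w w<z')
  ... | tri≈ _ refl _ = inj₁ (here refl)
  ... | tri> _ _ z'<w = inj₂ (gap-in-A w z'<w w<z)

theorem7p10 : (A : ℕ → Set) → Hypersimple A → (n : ℕ) → ¬ (ω ≤ᶜ JumpIter n (F A))
theorem7p10 A (_ , _ , undominated) n (f , f-computable , f-reduces) = undominated (g , g-computable , dominates)
  where
  -- z_m ≤ f 0 + ⋯ + f L where L = classBound n m bounds the classes below z_m
  g : ℕ → ℕ
  g m = sumUpTo f (classBound n m)

  g-computable : Computable g
  g-computable = computable-∘ (sumUpTo-computable f-computable) (classBound-computable n)

  f-injective : ∀ x y → JumpIter n (F A) (f x) (f y) → x ≡ y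
  f-injective x y = proj₂ (f-reduces x y)

  dominates : ∀ m z → NthOut A m z → z ≤ g m
  dominates m z nth with z ≤? g m
  ... | yes z≤gm = z≤gm
  ... | no  z≰gm = ⊥-elim (few-classes (JumpIter-classification Z cover n) f f-injective below)
    where
    Z = proj₁ (complement-below nth)
    cover = proj₂ (complement-below nth)
    below : ∀ i → i ≤ classBound n m → f i < z
    below i i≤L = ≤-<-trans (sumUpTo-≥ f i≤L) (≰⇒> z≰gm)
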